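{- Let $p$ be an odd prime, $q$ a power of $p$, and $n\ge 1$. For $n\ge 0$ let $f_n(x)=\sum_{j\ge 0}\binom{n}{2j+1}x^j\in\mathbb{F}_q[x]$. Then in $\mathbb{F}_q[x]$, $$F_n(1,x)=\left(\tfrac12\right)^{n-1}f_n(1-4x).$$ In particular, $F_n(1,x)$ is a permutation polynomial of $\mathbb{F}_q$ if and only if $f_n(x)$ is a permutation polynomial of $\mathbb{F}_q$.
   Context: For an integer $n\ge 1$, the $n$-th reversed Dickson polynomial of the third kind is $F_n(a,x)=\sum_{i=0}^{\lfloor n/2\rfloor}\frac{n-2i}{n-i}\binom{n-i}{i}(-x)^i a^{n-2i}$, where the coefficients $\frac{n-2i}{n-i}\binom{n-i}{i}=\binom{n-i}{i}-\binom{n-i-1}{i-1}$ (with $\binom{m}{ -1}=0$) are integers, read in $\mathbb{F}_q$. A polynomial $f\in\mathbb{F}_q[x]$ is a permutation polynomial of $\mathbb{F}_q$ if $c\mapsto f(c)$ is a bijection of $\mathbb{F}_q$. -}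

module Defs where

open import Level using (_⊔_)
open import Algebra.Bundles using (CommutativeRing)
open import Data.Nat using (ℕ; zero; suc; _∸_; _/_)
import Data.Nat as N
open import Data.Nat.Combinatorics using (_C_)
open import Data.Fin using (Fin)
open import Data.List using (List; []; _∷_; map; upTo)
open import Data.Product using (_×_; ∃)
open import Relation.Nullary using (¬_)
open import Relation.Binary.PropositionalEquality using (_≡_)

module RingOps {c ℓ} (R : CommutativeRing c ℓ) where
  open CommutativeRing R

  fromℕ : ℕ → Carrier
  fromℕ zero = 0#
  fromℕ (suc n) = 1# + fromℕ n

  pow : Carrier → ℕ → Carrier
  pow x zero = 1#
  pow x (suc n) = x * pow x n

record IsFiniteField {c ℓ} (R : CommutativeRing c ℓ) (q : ℕ) : Set (c ⊔ ℓ) where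
  open CommutativeRing R
  field
    nontrivial : ¬ (1# ≈ 0#)
    inverse    : ∀ x → ¬ (x ≈ 0#) → ∃ λ y → x * y ≈ 1#
    enum       : Fin q → Carrier
    enum-inj   : ∀ i j → enum i ≈ enum j → i ≡ j
    enum-surj  : ∀ x → ∃ λ i → enum i ≈ x

-- Univariate polynomials over R as coefficient lists (constant term first).
module Poly {c ℓ} (R : CommutativeRing c ℓ) where
  open CommutativeRing R
  open RingOps R public

  Pol : Set c
  Pol = List Carrier

  coeff : Pol → ℕ → Carrier
  coeff []       _       = 0#
  coeff (a ∷ f)  zero    = a
  coeff (a ∷ f)  (suc i) = coeff f i

  _≈P_ : Pol → Pol → Set ℓ
  f ≈P g = ∀ i → coeff f i ≈ coeff g i

  eval : Pol → Carrier → Carrier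
  eval []      x = 0#
  eval (a ∷ f) x = a + x * eval f x

  addP : Pol → Pol → Pol
  addP []      g       = g
  addP (a ∷ f) []      = a ∷ f
  addP (a ∷ f) (b ∷ g) = (a + b) ∷ addP f g

  scaleP : Carrier → Pol → Pol
  scaleP c f = map (c *_) f

  mulP : Pol → Pol → Pol
  mulP []      g = []
  mulP (a ∷ f) g = addP (scaleP a g) (0# ∷ mulP f g)

  compP : Pol → Pol → Pol
  compP []      g = []
  compP (a ∷ f) g = addP (a ∷ []) (mulP g (compP f g))

  -- integer coefficient (n-2i)/(n-i) * C(n-i,i) = C(n-i,i) - C(n-i-1,i-1), read in R
  dcoeff : ℕ → ℕ → Carrier
  dcoeff n zero    = fromℕ ((n ∸ 0) C 0)
  dcoeff n (suc j) = fromℕ ((n ∸ suc j) C suc j) - fromℕ ((n ∸ suc j ∸ 1) C j)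

  -- reversed Dickson polynomial of the third kind F_n(a,x):
  -- coefficient of x^i (0 ≤ i ≤ ⌊n/2⌋) is dcoeff n i * (-1)^i * a^(n-2i)
  revDickson3 : ℕ → Carrier → Pol
  revDickson3 n a =
    map (λ i → dcoeff n i * (pow (- 1#) i * pow a (n ∸ N._*_ 2 i))) (upTo (suc (n / 2)))

  -- f_n(x) = Σ_{j ≥ 0} C(n,2j+1) x^j  (terms with j ≥ n vanish)
  fpoly : ℕ → Pol
  fpoly n = map (λ j → fromℕ (n C suc (N._*_ 2 j))) (upTo n)

  IsPermPoly : Pol → Set (c ⊔ ℓ)
  IsPermPoly f = (∀ x y → eval f x ≈ eval f y → x ≈ y) × (∀ z → ∃ λ x → eval f x ≈ z)

module Submission where

-- For an odd prime p and a commutative ring R of characteristic p: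
-- F_n(1,x) = (1/2)^(n-1)·f_n(1 - 4x), and F_n(1,x) permutes R iff f_n does.
--
-- By Pascal's rule the coefficient (n-2i)/(n-i)·C(n-i,i) of F_n(1,x)
-- equals C(n-1-i,i), so F_{n+2} = F_{n+1} - x·F_n with F_1 = F_2 = 1.  The
-- second difference of binomial coefficients gives f_{n+2} + f_n =
-- 2·f_{n+1} + x·f_n; substituting the linear polynomial 1 - 4x turns this
-- into G_{n+2} = 2·G_{n+1} - 4x·G_n for G_n = f_n(1 - 4x).  Hence, with
-- h·2 = 1, the sequence h^(n-1)·G_n obeys the recurrence of F_n and has the
-- same first two terms, and the identity follows coefficientwise.  For the
-- permutation statement, F_n(1,x) = u·f_n(ℓ x) with u a unit and ℓ x = 1 - 4x
-- a bijection; 2 is invertible because p = 1 + 2k vanishes in R.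

open import Defs
open import Algebra.Bundles using (CommutativeRing)
open import Data.Nat using (ℕ; _^_; _≤_; _∸_)
open import Data.Nat.Primality using (Prime)
open import Data.Product using (_×_)
open import Data.List using ([]; _∷_)
open import Function.Bundles using (_⇔_)
open import Relation.Binary.PropositionalEquality using (_≡_; _≢_)
open import Algebra.Solver.Ring.AlmostCommutativeRing
  using (fromCommutativeRing; _-Raw-AlmostCommutative⟶_)
open import Data.Empty using (⊥-elim)
open import Data.Integer as ℤ using (ℤ; +_; -[1+_])
import Data.Integer.Properties as ℤ
open import Data.List using (map; applyUpTo)
open import Data.Maybe using (Maybe; just; nothing)
open import Data.Nat as ℕ using (zero; suc; _<_; _/_; _%_; s≤s; z≤n)
import Data.Nat.Properties as ℕ
open import Data.Nat.Combinatorics using (_C_; k>n⇒nCk≡0; nCk+nC[k+1]≡[n+1]C[k+1]; nC1≡n)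
open import Data.Nat.DivMod using (m≡m%n+[m/n]*n; m%n<n; m/n*n≤m; m*n/n≡m; /-monoˡ-≤)
open import Data.Nat.Divisibility using (m%n≡0⇒n∣m)
open import Data.Nat.Primality using (prime⇒irreducible)
open import Data.Nat.Tactic.RingSolver using (solve-∀)
open import Data.Product using (_,_; ∃)
import Data.Sign as Sign
open import Data.Sum using (inj₁; inj₂)
open import Function.Base using (_∘_)
open import Function.Bundles using (mk⇔)
open import Relation.Nullary using (yes; no)
import Relation.Binary.PropositionalEquality as ≡

module Binomials where
  open import Data.Nat.Base using (_+_; _*_)
  open ≡ using (refl; sym; trans; cong; cong₂)
  open ≡.≡-Reasoning

  pascal : ∀ n k → suc n C suc k ≡ n C k + n C suc k
  pascal n k = sym (nCk+nC[k+1]≡[n+1]C[k+1] n k)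

  binomial-second-difference : ∀ n k →
    suc (suc n) C suc (suc k) + n C suc (suc k) ≡ 2 * (suc n C suc (suc k)) + n C k
  binomial-second-difference n k = begin
    suc (suc n) C suc (suc k) + n C suc (suc k)
      ≡⟨ cong (_+ n C suc (suc k)) (trans (pascal (suc n) (suc k)) (cong₂ _+_ (pascal n k) (pascal n (suc k)))) ⟩
    (n C k + n C suc k) + (n C suc k + n C suc (suc k)) + n C suc (suc k)
      ≡⟨ rearrange (n C k) (n C suc k) (n C suc (suc k)) ⟩
    2 * (n C suc k + n C suc (suc k)) + n C k
      ≡⟨ cong (λ t → 2 * t + n C k) (pascal n (suc k)) ⟨
    2 * (suc n C suc (suc k)) + n C k ∎
    where
    rearrange : ∀ a b c → (a + b) + (b + c) + c ≡ 2 * (b + c) + a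
    rearrange = solve-∀

  binomial-second-difference₁ : ∀ n → suc (suc n) C 1 + n C 1 ≡ 2 * (suc n C 1)
  binomial-second-difference₁ n
    rewrite nC1≡n (suc (suc n)) | nC1≡n n | nC1≡n (suc n) = double n
    where
    double : ∀ n → suc (suc n) + n ≡ 2 * suc n
    double = solve-∀

  oddBinomial : ℕ → ℕ → ℕ
  oddBinomial n i = n C suc (2 * i)

  oddBinomial-rec₀ : ∀ n → oddBinomial (suc (suc n)) 0 + oddBinomial n 0 ≡ 2 * oddBinomial (suc n) 0 + 0
  oddBinomial-rec₀ n = trans (binomial-second-difference₁ n) (sym (ℕ.+-identityʳ _))

  oddBinomial-rec : ∀ n j →
    oddBinomial (suc (suc n)) (suc j) + oddBinomial n (suc j) ≡ 2 * oddBinomial (suc n) (suc j) + oddBinomial n j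
  oddBinomial-rec n j = ≡.subst (λ k → suc (suc n) C suc k + n C suc k ≡ 2 * (suc n C suc k) + oddBinomial n j)
    (sym (ℕ.*-suc 2 j)) (binomial-second-difference n (suc (2 * j)))

  -- The numbers C(m-i, i); up to sign they are the coefficients of
  -- F_{m+1}(1,x) (see dcoeff≈dicksonNumber).
  dicksonNumber : ℕ → ℕ → ℕ
  dicksonNumber m i = (m ∸ i) C i

  -- C(m+2-(i+1), i+1) = C(m+1-(i+1), i+1) + C(m-i, i): the recurrence
  -- behind F_{n+2} = F_{n+1} - x·F_n.
  dicksonNumber-rec : ∀ m i →
    dicksonNumber (suc (suc m)) (suc i) ≡ dicksonNumber (suc m) (suc i) + dicksonNumber m i
  dicksonNumber-rec m i with i ℕ.≤? m
  ... | yes i≤m = begin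
    (suc m ∸ i) C suc i             ≡⟨ cong (_C suc i) (ℕ.+-∸-assoc 1 i≤m) ⟩
    suc (m ∸ i) C suc i             ≡⟨ pascal (m ∸ i) i ⟩
    (m ∸ i) C i + (m ∸ i) C suc i   ≡⟨ ℕ.+-comm ((m ∸ i) C i) _ ⟩
    (m ∸ i) C suc i + (m ∸ i) C i   ∎
  ... | no i≰m = begin
    (suc m ∸ i) C suc i             ≡⟨ cong (_C suc i) (ℕ.m≤n⇒m∸n≡0 m<i) ⟩
    0                               ≡⟨ cong₂ _+_ (vanish (suc i) (ℕ.m≤n⇒m≤1+n m<i)) (vanish i m<i) ⟨
    (m ∸ i) C suc i + (m ∸ i) C i   ∎
    where
    m<i : m < i
    m<i = ℕ.≰⇒> i≰m
    vanish : ∀ k → m < k → (m ∸ i) C k ≡ 0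
    vanish k m<k = k>n⇒nCk≡0 (ℕ.≤-<-trans (ℕ.m∸n≤m m i) m<k)

  dicksonNumber-vanish : ∀ m i → m < i + i → dicksonNumber m i ≡ 0
  dicksonNumber-vanish m (suc j) m<2i = k>n⇒nCk≡0 (ℕ.m<n+o⇒m∸n<o m (suc j) m<2i)

  -- Pascal's rule in the form C(m-j, k+1) = C(m-j-1, k) + C(m-j-1, k+1)
  -- for j < m; with k = j it shows that the coefficient
  -- (n-2i)/(n-i)·C(n-i,i) of F_n equals C(n-1-i, i).
  dickson-pascal : ∀ m j k → j < m → (m ∸ j) C suc k ≡ (m ∸ j ∸ 1) C k + (m ∸ suc j) C suc k
  dickson-pascal (suc m) zero    k _         = pascal m k
  dickson-pascal (suc m) (suc j) k (s≤s j<m) = dickson-pascal m j k j<m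

  double≡*2 : ∀ k → k + k ≡ k * 2
  double≡*2 = solve-∀

  ≤half⇒double≤ : ∀ {n i} → i ≤ n / 2 → i + i ≤ n
  ≤half⇒double≤ {n} {i} i≤n/2 = ℕ.≤-trans (ℕ.+-mono-≤ i≤n/2 i≤n/2)
    (ℕ.≤-trans (ℕ.≤-reflexive (double≡*2 (n / 2))) (m/n*n≤m n 2))

  half<⇒<double : ∀ {n i} → n / 2 < i → n < i + i
  half<⇒<double {n} {i} n/2<i = ℕ.≰⇒> λ 2i≤n →
    ℕ.<⇒≱ n/2<i (ℕ.≤-trans (ℕ.≤-reflexive (sym (halve i))) (/-monoˡ-≤ 2 2i≤n))
    where
    halve : ∀ k → (k + k) / 2 ≡ k
    halve k = trans (cong (_/ 2) (double≡*2 k)) (m*n/n≡m k 2)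

  oddPrime-decomposition : ∀ {p} → Prime p → p ≢ 2 → p ≡ 1 + (p / 2) * 2
  oddPrime-decomposition {p} p-prime p≢2 with p % 2 in p%2≡r | m%n<n p 2
  ... | 1           | _ = trans (m≡m%n+[m/n]*n p 2) (cong (_+ (p / 2) * 2) p%2≡r)
  ... | suc (suc _) | s≤s (s≤s ())
  ... | 0           | _ with prime⇒irreducible p-prime (m%n≡0⇒n∣m p 2 p%2≡r)
  ...   | inj₁ ()
  ...   | inj₂ 2≡p = ⊥-elim (p≢2 (sym 2≡p))

module Development {r₁ r₂} (R : CommutativeRing r₁ r₂) where
  open CommutativeRing R hiding (zero)
  open Poly R
  open Binomials
  open import Relation.Binary.Reasoning.Setoid setoid
  open import Algebra.Properties.Ring ring
    using (-‿involutive; -‿distribˡ-*; -‿distribʳ-*; -0#≈0#; -‿+-comm; -1*x≈-x)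
  open import Algebra.Properties.CommutativeSemigroup +-commutativeSemigroup using (interchange)
  open import Algebra.Properties.Group +-group using (∙-cancelʳ)
  open import Algebra.Properties.Semiring.Mult semiring using (×-homo-+; ×1-homo-*)
    renaming (_×_ to _·_)

  fromℕ≈×1# : ∀ n → fromℕ n ≈ n · 1#
  fromℕ≈×1# zero    = refl
  fromℕ≈×1# (suc n) = +-congˡ (fromℕ≈×1# n)

  fromℕ-+ : ∀ m n → fromℕ (m ℕ.+ n) ≈ fromℕ m + fromℕ n
  fromℕ-+ m n = begin
    fromℕ (m ℕ.+ n)          ≈⟨ fromℕ≈×1# (m ℕ.+ n) ⟩
    (m ℕ.+ n) · 1#           ≈⟨ ×-homo-+ 1# m n ⟩
    m · 1# + n · 1#          ≈⟨ +-cong (fromℕ≈×1# m) (fromℕ≈×1# n) ⟨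
    fromℕ m + fromℕ n        ∎

  fromℕ-* : ∀ m n → fromℕ (m ℕ.* n) ≈ fromℕ m * fromℕ n
  fromℕ-* m n = begin
    fromℕ (m ℕ.* n)          ≈⟨ fromℕ≈×1# (m ℕ.* n) ⟩
    (m ℕ.* n) · 1#           ≈⟨ ×1-homo-* m n ⟩
    (m · 1#) * (n · 1#)      ≈⟨ *-cong (fromℕ≈×1# m) (fromℕ≈×1# n) ⟨
    fromℕ m * fromℕ n        ∎

  -- Its extension ⟦_⟧ℤ : ℤ → R is a ring homomorphism; this lets the
  -- ring solver normalise expressions with integer constants in R.
  ⟦_⟧ℤ : ℤ → Carrier
  ⟦ + n      ⟧ℤ = fromℕ n
  ⟦ -[1+ n ] ⟧ℤ = - fromℕ (suc n)

  ⊖-homo : ∀ m n → ⟦ m ℤ.⊖ n ⟧ℤ ≈ fromℕ m - fromℕ n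
  ⊖-homo zero    zero    = sym (-‿inverseʳ 0#)
  ⊖-homo zero    (suc n) = sym (+-identityˡ _)
  ⊖-homo (suc m) zero    = sym (trans (+-congˡ -0#≈0#) (+-identityʳ _))
  ⊖-homo (suc m) (suc n) = begin
    ⟦ suc m ℤ.⊖ suc n ⟧ℤ                ≡⟨ ≡.cong ⟦_⟧ℤ (ℤ.[1+m]⊖[1+n]≡m⊖n m n) ⟩
    ⟦ m ℤ.⊖ n ⟧ℤ                        ≈⟨ ⊖-homo m n ⟩
    fromℕ m - fromℕ n                   ≈⟨ +-identityˡ _ ⟨
    0# + (fromℕ m - fromℕ n)            ≈⟨ +-congʳ (-‿inverseʳ 1#) ⟨
    (1# - 1#) + (fromℕ m - fromℕ n)     ≈⟨ interchange 1# (- 1#) (fromℕ m) (- fromℕ n) ⟩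
    (1# + fromℕ m) + (- 1# - fromℕ n)   ≈⟨ +-congˡ (-‿+-comm 1# (fromℕ n)) ⟩
    (1# + fromℕ m) - (1# + fromℕ n)     ∎

  +-homo : ∀ i j → ⟦ i ℤ.+ j ⟧ℤ ≈ ⟦ i ⟧ℤ + ⟦ j ⟧ℤ
  +-homo (+ m)    (+ n)    = fromℕ-+ m n
  +-homo (+ m)    -[1+ n ] = ⊖-homo m (suc n)
  +-homo -[1+ m ] (+ n)    = trans (⊖-homo n (suc m)) (+-comm _ _)
  +-homo -[1+ m ] -[1+ n ] = begin
    - fromℕ (suc (suc (m ℕ.+ n)))         ≡⟨ ≡.cong (λ k → - fromℕ (suc k)) (≡.sym (ℕ.+-suc m n)) ⟩
    - fromℕ (suc (m ℕ.+ suc n))           ≈⟨ -‿cong (trans (+-congˡ (fromℕ-+ m (suc n))) (sym (+-assoc _ _ _))) ⟩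
    - (fromℕ (suc m) + fromℕ (suc n))   ≈⟨ -‿+-comm _ _ ⟨
    - fromℕ (suc m) - fromℕ (suc n)     ∎

  +◃-homo : ∀ n → ⟦ Sign.+ ℤ.◃ n ⟧ℤ ≈ fromℕ n
  +◃-homo n = reflexive (≡.cong ⟦_⟧ℤ (ℤ.+◃n≡+n n))

  -◃-homo : ∀ n → ⟦ Sign.- ℤ.◃ n ⟧ℤ ≈ - fromℕ n
  -◃-homo zero    = sym -0#≈0#
  -◃-homo (suc n) = refl

  *-homo : ∀ i j → ⟦ i ℤ.* j ⟧ℤ ≈ ⟦ i ⟧ℤ * ⟦ j ⟧ℤ
  *-homo (+ m)    (+ n)    = trans (+◃-homo (m ℕ.* n)) (fromℕ-* m n)
  *-homo (+ m)    -[1+ n ] =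
    trans (-◃-homo (m ℕ.* suc n)) (trans (-‿cong (fromℕ-* m (suc n))) (-‿distribʳ-* _ _))
  *-homo -[1+ m ] (+ n)    =
    trans (-◃-homo (suc m ℕ.* n)) (trans (-‿cong (fromℕ-* (suc m) n)) (-‿distribˡ-* _ _))
  *-homo -[1+ m ] -[1+ n ] = begin
    ⟦ Sign.+ ℤ.◃ (suc m ℕ.* suc n) ⟧ℤ     ≈⟨ +◃-homo (suc m ℕ.* suc n) ⟩
    fromℕ (suc m ℕ.* suc n)               ≈⟨ fromℕ-* (suc m) (suc n) ⟩
    fromℕ (suc m) * fromℕ (suc n)       ≈⟨ -‿involutive _ ⟨
    - - (fromℕ (suc m) * fromℕ (suc n)) ≈⟨ -‿cong (-‿distribˡ-* _ _) ⟩
    - (- fromℕ (suc m) * fromℕ (suc n)) ≈⟨ -‿distribʳ-* _ _ ⟩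
    - fromℕ (suc m) * - fromℕ (suc n)   ∎

  -‿homo : ∀ i → ⟦ ℤ.- i ⟧ℤ ≈ - ⟦ i ⟧ℤ
  -‿homo (+ zero)  = sym -0#≈0#
  -‿homo (+ suc n) = refl
  -‿homo -[1+ n ]  = sym (-‿involutive _)

  ℤ⟶R : ℤ.+-*-rawRing -Raw-AlmostCommutative⟶ fromCommutativeRing R
  ℤ⟶R = record
    { ⟦_⟧ = ⟦_⟧ℤ ; +-homo = +-homo ; *-homo = *-homo ; -‿homo = -‿homo
    ; 0-homo = refl ; 1-homo = +-identityʳ 1# }

  ℤ-equal? : ∀ i j → Maybe (⟦ i ⟧ℤ ≈ ⟦ j ⟧ℤ)
  ℤ-equal? i j with i ℤ.≟ j
  ... | yes ≡.refl = just refl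
  ... | no _       = nothing

  open import Algebra.Solver.Ring ℤ.+-*-rawRing (fromCommutativeRing R) ℤ⟶R ℤ-equal?
    using (solve; _:+_; _:*_; _:-_; :-_; _:=_; con)

  Seq : Set r₁
  Seq = ℕ → Carrier

  _≋_ : Seq → Seq → Set r₂
  u ≋ v = ∀ i → u i ≈ v i

  shift : Seq → Seq
  shift u zero    = 0#
  shift u (suc i) = u i

  shift-cong : ∀ {u v} → u ≋ v → shift u ≋ shift v
  shift-cong u≋v zero    = refl
  shift-cong u≋v (suc i) = u≋v i

  shift-scale : ∀ a u → shift (λ j → a * u j) ≋ (λ i → a * shift u i)
  shift-scale a u zero    = sym (zeroʳ a)
  shift-scale a u (suc i) = refl

  coeff-addP : ∀ f g i → coeff (addP f g) i ≈ coeff f i + coeff g i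
  coeff-addP []      g       i       = sym (+-identityˡ _)
  coeff-addP (a ∷ f) []      i       = sym (+-identityʳ _)
  coeff-addP (a ∷ f) (b ∷ g) zero    = refl
  coeff-addP (a ∷ f) (b ∷ g) (suc i) = coeff-addP f g i

  coeff-scaleP : ∀ s f i → coeff (scaleP s f) i ≈ s * coeff f i
  coeff-scaleP s []      i       = sym (zeroʳ s)
  coeff-scaleP s (a ∷ f) zero    = refl
  coeff-scaleP s (a ∷ f) (suc i) = coeff-scaleP s f i

  coeff-mulP-linear : ∀ b c P i → coeff (mulP (b ∷ c ∷ []) P) i ≈ b * coeff P i + c * shift (coeff P) i
  coeff-mulP-linear b c P zero = begin
    coeff (addP (scaleP b P) (0# ∷ cP)) 0             ≈⟨ coeff-addP (scaleP b P) (0# ∷ cP) 0 ⟩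
    coeff (scaleP b P) 0 + 0#                         ≈⟨ +-cong (coeff-scaleP b P 0) (sym (zeroʳ c)) ⟩
    b * coeff P 0 + c * 0#                            ∎
    where cP = addP (scaleP c P) (0# ∷ [])
  coeff-mulP-linear b c P (suc i) = begin
    coeff (addP (scaleP b P) (0# ∷ cP)) (suc i)       ≈⟨ coeff-addP (scaleP b P) (0# ∷ cP) (suc i) ⟩
    coeff (scaleP b P) (suc i) + coeff cP i           ≈⟨ +-cong (coeff-scaleP b P (suc i)) (coeff-addP (scaleP c P) (0# ∷ []) i) ⟩
    b * coeff P (suc i) + (coeff (scaleP c P) i + coeff (0# ∷ []) i)
      ≈⟨ +-congˡ (trans (+-cong (coeff-scaleP c P i) (coeff-0 i)) (+-identityʳ _)) ⟩
    b * coeff P (suc i) + c * coeff P i               ∎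
    where
    cP = addP (scaleP c P) (0# ∷ [])
    coeff-0 : ∀ i → coeff (0# ∷ []) i ≈ 0#
    coeff-0 zero    = refl
    coeff-0 (suc i) = refl

  coeff-map-applyUpTo : ∀ (g : ℕ → Carrier) f (u : Seq) k →
    (∀ i → i < k → g (f i) ≈ u i) → (∀ i → k ≤ i → u i ≈ 0#) → coeff (map g (applyUpTo f k)) ≋ u
  coeff-map-applyUpTo g f u zero    _      beyond i       = sym (beyond i z≤n)
  coeff-map-applyUpTo g f u (suc k) within beyond zero    = within 0 (s≤s z≤n)
  coeff-map-applyUpTo g f u (suc k) within beyond (suc i) =
    coeff-map-applyUpTo g (f ∘ suc) (u ∘ suc) k
      (λ j j<k → within (suc j) (s≤s j<k)) (λ j k≤j → beyond (suc j) (s≤s k≤j)) i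

  -- Functionals φ on polynomials given by a Horner recursion
  -- φ [] ≈ 0, φ (a ∷ f) ≈ step a (φ f), with values in I → R: the
  -- evaluation map (I = R) and composition with a linear polynomial
  -- (I = ℕ, coefficients).
  module Horner {i} {I : Set i} (step : Carrier → (I → Carrier) → I → Carrier)
    (step-cong : ∀ {a a' u u'} → a ≈ a' → (∀ k → u k ≈ u' k) → ∀ k → step a u k ≈ step a' u' k)
    (φ : Pol → I → Carrier) (φ-[] : ∀ k → φ [] k ≈ 0#) (φ-∷ : ∀ a f k → φ (a ∷ f) k ≈ step a (φ f) k)
    where

    resp : (∀ k → step 0# (λ _ → 0#) k ≈ 0#) → ∀ f g → f ≈P g → ∀ k → φ f k ≈ φ g k
    resp step-0 = go
      where
      vanish : ∀ f → (∀ j → coeff f j ≈ 0#) → ∀ k → φ f k ≈ 0#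
      vanish []      _  = φ-[]
      vanish (a ∷ f) f0 k =
        trans (φ-∷ a f k) (trans (step-cong (f0 0) (vanish f (f0 ∘ suc)) k) (step-0 k))
      go : ∀ f g → f ≈P g → ∀ k → φ f k ≈ φ g k
      go []      g       f≈g k = trans (φ-[] k) (sym (vanish g (λ j → sym (f≈g j)) k))
      go (a ∷ f) []      f≈g k = trans (vanish (a ∷ f) f≈g k) (sym (φ-[] k))
      go (a ∷ f) (b ∷ g) f≈g k =
        trans (φ-∷ a f k) (trans (step-cong (f≈g 0) (go f g (f≈g ∘ suc)) k) (sym (φ-∷ b g k)))

    additive : (∀ a b u v k → step (a + b) (λ j → u j + v j) k ≈ step a u k + step b v k) →
      ∀ f g k → φ (addP f g) k ≈ φ f k + φ g k
    additive step-+ []      g       k = trans (sym (+-identityˡ _)) (+-congʳ (sym (φ-[] k)))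
    additive step-+ (a ∷ f) []      k = trans (sym (+-identityʳ _)) (+-congˡ (sym (φ-[] k)))
    additive step-+ (a ∷ f) (b ∷ g) k = begin
      φ ((a + b) ∷ addP f g) k                      ≈⟨ φ-∷ (a + b) (addP f g) k ⟩
      step (a + b) (φ (addP f g)) k                 ≈⟨ step-cong refl (additive step-+ f g) k ⟩
      step (a + b) (λ j → φ f j + φ g j) k          ≈⟨ step-+ a b (φ f) (φ g) k ⟩
      step a (φ f) k + step b (φ g) k               ≈⟨ +-cong (φ-∷ a f k) (φ-∷ b g k) ⟨
      φ (a ∷ f) k + φ (b ∷ g) k                     ∎

    homogeneous : (∀ s a u k → step (s * a) (λ j → s * u j) k ≈ s * step a u k) →
      ∀ s f k → φ (scaleP s f) k ≈ s * φ f k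
    homogeneous step-* s []      k = trans (φ-[] k) (sym (trans (*-congˡ (φ-[] k)) (zeroʳ s)))
    homogeneous step-* s (a ∷ f) k = begin
      φ (s * a ∷ scaleP s f) k                      ≈⟨ φ-∷ (s * a) (scaleP s f) k ⟩
      step (s * a) (φ (scaleP s f)) k               ≈⟨ step-cong refl (homogeneous step-* s f) k ⟩
      step (s * a) (λ j → s * φ f j) k              ≈⟨ step-* s a (φ f) k ⟩
      s * step a (φ f) k                            ≈⟨ *-congˡ (φ-∷ a f k) ⟨
      s * φ (a ∷ f) k                               ∎

  evalStep : Carrier → (Carrier → Carrier) → Carrier → Carrier
  evalStep a u x = a + x * u x

  module Evaluation = Horner evalStep (λ a≈a' u≈u' x → +-cong a≈a' (*-congˡ (u≈u' x)))
    eval (λ _ → refl) (λ _ _ _ → refl)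

  eval-resp : ∀ f g → f ≈P g → ∀ x → eval f x ≈ eval g x
  eval-resp = Evaluation.resp (λ x → trans (+-identityˡ _) (zeroʳ x))

  eval-addP : ∀ f g x → eval (addP f g) x ≈ eval f x + eval g x
  eval-addP = Evaluation.additive λ a b u v x →
    solve 5 (λ a b x U V → (a :+ b) :+ x :* (U :+ V) := (a :+ x :* U) :+ (b :+ x :* V))
      refl a b x (u x) (v x)

  eval-scaleP : ∀ s f x → eval (scaleP s f) x ≈ s * eval f x
  eval-scaleP = Evaluation.homogeneous λ s a u x →
    solve 4 (λ s a x U → s :* a :+ x :* (s :* U) := s :* (a :+ x :* U)) refl s a x (u x)

  eval-mulP : ∀ f g x → eval (mulP f g) x ≈ eval f x * eval g x
  eval-mulP []      g x = sym (zeroˡ _)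
  eval-mulP (a ∷ f) g x = begin
    eval (addP (scaleP a g) (0# ∷ mulP f g)) x            ≈⟨ eval-addP (scaleP a g) (0# ∷ mulP f g) x ⟩
    eval (scaleP a g) x + (0# + x * eval (mulP f g) x)    ≈⟨ +-cong (eval-scaleP a g x)
                                                              (trans (+-identityˡ _) (*-congˡ (eval-mulP f g x))) ⟩
    a * eval g x + x * (eval f x * eval g x)              ≈⟨ solve 4 (λ a x F G → a :* G :+ x :* (F :* G) := (a :+ x :* F) :* G)
                                                               refl a x (eval f x) (eval g x) ⟩
    (a + x * eval f x) * eval g x                         ∎

  eval-compP : ∀ f g x → eval (compP f g) x ≈ eval f (eval g x)
  eval-compP []      g x = refl
  eval-compP (a ∷ f) g x = begin
    eval (addP (a ∷ []) (mulP g (compP f g))) x           ≈⟨ eval-addP (a ∷ []) (mulP g (compP f g)) x ⟩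
    (a + x * 0#) + eval (mulP g (compP f g)) x            ≈⟨ +-cong (trans (+-congˡ (zeroʳ x)) (+-identityʳ a))
                                                                    (eval-mulP g (compP f g) x) ⟩
    a + eval g x * eval (compP f g) x                     ≈⟨ +-congˡ (*-congˡ (eval-compP f g x)) ⟩
    a + eval g x * eval f (eval g x)                      ∎

  eval-cong : ∀ f {x y} → x ≈ y → eval f x ≈ eval f y
  eval-cong []      x≈y = refl
  eval-cong (a ∷ f) x≈y = +-congˡ (*-cong x≈y (eval-cong f x≈y))

  module Composition (b c : Carrier) where

    composed : Pol → Seq
    composed f = coeff (compP f (b ∷ c ∷ []))

    -- The coefficients of a + (b + c·x)·u(x).
    linearStep : Carrier → Seq → Seq
    linearStep a u zero    = a + b * u 0
    linearStep a u (suc i) = b * u (suc i) + c * u i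

    linearStep-cong : ∀ {a a' u u'} → a ≈ a' → u ≋ u' → linearStep a u ≋ linearStep a' u'
    linearStep-cong a≈a' u≋u' zero    = +-cong a≈a' (*-congˡ (u≋u' 0))
    linearStep-cong a≈a' u≋u' (suc i) = +-cong (*-congˡ (u≋u' (suc i))) (*-congˡ (u≋u' i))

    linearStep-zero : ∀ u → linearStep 0# u ≋ (λ i → b * u i + c * shift u i)
    linearStep-zero u zero    = trans (+-identityˡ _) (sym (trans (+-congˡ (zeroʳ c)) (+-identityʳ _)))
    linearStep-zero u (suc i) = refl

    composed-∷ : ∀ a f → composed (a ∷ f) ≋ linearStep a (composed f)
    composed-∷ a f i = trans (coeff-addP (a ∷ []) (mulP (b ∷ c ∷ []) (compP f (b ∷ c ∷ []))) i) (at i)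
      where
      P = compP f (b ∷ c ∷ [])
      at : ∀ i → coeff (a ∷ []) i + coeff (mulP (b ∷ c ∷ []) P) i ≈ linearStep a (coeff P) i
      at zero    = +-congˡ (trans (coeff-mulP-linear b c P 0) (trans (+-congˡ (zeroʳ c)) (+-identityʳ _)))
      at (suc i) = trans (+-identityˡ _) (coeff-mulP-linear b c P (suc i))

    module Linear = Horner linearStep linearStep-cong composed (λ _ → refl) composed-∷

    composed-resp : ∀ f g → f ≈P g → composed f ≋ composed g
    composed-resp = Linear.resp step-0
      where
      step-0 : linearStep 0# (λ _ → 0#) ≋ (λ _ → 0#)
      step-0 zero    = solve 1 (λ b → con (+ 0) :+ b :* con (+ 0) := con (+ 0)) refl b
      step-0 (suc i) = solve 2 (λ b c → b :* con (+ 0) :+ c :* con (+ 0) := con (+ 0)) refl b c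

    composed-addP : ∀ f g → composed (addP f g) ≋ (λ i → composed f i + composed g i)
    composed-addP = Linear.additive step-+
      where
      step-+ : ∀ a a' u v → linearStep (a + a') (λ j → u j + v j) ≋ (λ i → linearStep a u i + linearStep a' v i)
      step-+ a a' u v zero    = solve 5 (λ a a' b U V → (a :+ a') :+ b :* (U :+ V) := (a :+ b :* U) :+ (a' :+ b :* V))
                                  refl a a' b (u 0) (v 0)
      step-+ a a' u v (suc i) = solve 6 (λ b c U V U' V' → b :* (U :+ V) :+ c :* (U' :+ V') := (b :* U :+ c :* U') :+ (b :* V :+ c :* V'))
                                  refl b c (u (suc i)) (v (suc i)) (u i) (v i)

    composed-scaleP : ∀ s f → composed (scaleP s f) ≋ (λ i → s * composed f i)
    composed-scaleP = Linear.homogeneous step-*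
      where
      step-* : ∀ s a u → linearStep (s * a) (λ j → s * u j) ≋ (λ i → s * linearStep a u i)
      step-* s a u zero    = solve 4 (λ s a b U → s :* a :+ b :* (s :* U) := s :* (a :+ b :* U)) refl s a b (u 0)
      step-* s a u (suc i) = solve 5 (λ s b c U U' → b :* (s :* U) :+ c :* (s :* U') := s :* (b :* U :+ c :* U'))
                               refl s b c (u (suc i)) (u i)

    composed-constant : ∀ a → composed (a ∷ []) ≋ coeff (a ∷ [])
    composed-constant a zero    = trans (composed-∷ a [] 0) (trans (+-congˡ (zeroʳ b)) (+-identityʳ a))
    composed-constant a (suc i) = trans (composed-∷ a [] (suc i)) (trans (+-cong (zeroʳ b) (zeroʳ c)) (+-identityˡ 0#))

  permPoly-transfer : ∀ F f (ℓ μ : Carrier → Carrier) u v →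
    (∀ {x y} → x ≈ y → μ x ≈ μ y) → (∀ x → μ (ℓ x) ≈ x) → (∀ y → ℓ (μ y) ≈ y) → u * v ≈ 1# →
    (∀ x → eval F x ≈ u * eval f (ℓ x)) → IsPermPoly f → IsPermPoly F
  permPoly-transfer F f ℓ μ u v μ-cong μℓ ℓμ uv≈1 F≈uf∘ℓ (f-inj , f-surj) = F-inj , F-surj
    where
    cancel : ∀ {a a'} → u * a ≈ u * a' → a ≈ a'
    cancel {a} {a'} ua≈ua' = begin
      a               ≈⟨ *-identityˡ a ⟨
      1# * a          ≈⟨ *-congʳ (trans (*-comm v u) uv≈1) ⟨
      (v * u) * a     ≈⟨ *-assoc v u a ⟩
      v * (u * a)     ≈⟨ *-congˡ ua≈ua' ⟩
      v * (u * a')    ≈⟨ *-assoc v u a' ⟨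
      (v * u) * a'    ≈⟨ *-congʳ (trans (*-comm v u) uv≈1) ⟩
      1# * a'         ≈⟨ *-identityˡ a' ⟩
      a'              ∎
    F-inj : ∀ x y → eval F x ≈ eval F y → x ≈ y
    F-inj x y Fx≈Fy = begin
      x          ≈⟨ μℓ x ⟨
      μ (ℓ x)    ≈⟨ μ-cong (f-inj (ℓ x) (ℓ y) (cancel (trans (sym (F≈uf∘ℓ x)) (trans Fx≈Fy (F≈uf∘ℓ y))))) ⟩
      μ (ℓ y)    ≈⟨ μℓ y ⟩
      y          ∎
    F-surj : ∀ z → ∃ λ x → eval F x ≈ z
    F-surj z with f-surj (v * z)
    ... | y , fy≈vz = μ y , (begin
      eval F (μ y)           ≈⟨ F≈uf∘ℓ (μ y) ⟩
      u * eval f (ℓ (μ y))   ≈⟨ *-congˡ (trans (eval-cong f (ℓμ y)) fy≈vz) ⟩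
      u * (v * z)            ≈⟨ *-assoc u v z ⟨
      (u * v) * z            ≈⟨ trans (*-congʳ uv≈1) (*-identityˡ z) ⟩
      z                      ∎)

  -- The relation F(x) ≈ u·f(ℓ x) can be inverted to f(y) ≈ v·F(μ y), so
  -- F is a permutation polynomial exactly when f is.
  permPoly-equivalence : ∀ F f (ℓ μ : Carrier → Carrier) u v →
    (∀ {x y} → x ≈ y → ℓ x ≈ ℓ y) → (∀ {x y} → x ≈ y → μ x ≈ μ y) →
    (∀ x → μ (ℓ x) ≈ x) → (∀ y → ℓ (μ y) ≈ y) → u * v ≈ 1# →
    (∀ x → eval F x ≈ u * eval f (ℓ x)) → IsPermPoly F ⇔ IsPermPoly f
  permPoly-equivalence F f ℓ μ u v ℓ-cong μ-cong μℓ ℓμ uv≈1 F≈uf∘ℓ =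
    mk⇔ (permPoly-transfer f F μ ℓ v u ℓ-cong ℓμ μℓ vu≈1 f≈vF∘μ)
        (permPoly-transfer F f ℓ μ u v μ-cong μℓ ℓμ uv≈1 F≈uf∘ℓ)
    where
    vu≈1 : v * u ≈ 1#
    vu≈1 = trans (*-comm v u) uv≈1
    f≈vF∘μ : ∀ y → eval f y ≈ v * eval F (μ y)
    f≈vF∘μ y = begin
      eval f y                   ≈⟨ trans (*-congʳ vu≈1) (*-identityˡ _) ⟨
      (v * u) * eval f y         ≈⟨ *-assoc v u _ ⟩
      v * (u * eval f y)         ≈⟨ *-congˡ (trans (F≈uf∘ℓ (μ y)) (*-congˡ (eval-cong f (ℓμ y)))) ⟨
      v * eval F (μ y)           ∎

  linear-inverseˡ : ∀ b c d → c * d ≈ 1# → ∀ y → eval (b ∷ c ∷ []) (d * (y - b)) ≈ y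
  linear-inverseˡ b c d cd≈1 y = begin
    b + d * (y - b) * (c + d * (y - b) * 0#)   ≈⟨ solve 4 (λ b c d y → b :+ d :* (y :- b) :* (c :+ d :* (y :- b) :* con (+ 0))
                                                          := b :+ (c :* d) :* (y :- b)) refl b c d y ⟩
    b + (c * d) * (y - b)                      ≈⟨ +-congˡ (trans (*-congʳ cd≈1) (*-identityˡ _)) ⟩
    b + (y - b)                                ≈⟨ solve 2 (λ b y → b :+ (y :- b) := y) refl b y ⟩
    y                                          ∎

  linear-inverseʳ : ∀ b c d → c * d ≈ 1# → ∀ x → d * (eval (b ∷ c ∷ []) x - b) ≈ x
  linear-inverseʳ b c d cd≈1 x = begin
    d * ((b + x * (c + x * 0#)) - b)   ≈⟨ solve 4 (λ b c d x → d :* ((b :+ x :* (c :+ x :* con (+ 0))) :- b) := (c :* d) :* x)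
                                                 refl b c d x ⟩
    (c * d) * x                        ≈⟨ trans (*-congʳ cd≈1) (*-identityˡ x) ⟩
    x                                  ∎

  pow-1# : ∀ n → pow 1# n ≈ 1#
  pow-1# zero    = refl
  pow-1# (suc n) = trans (*-identityˡ _) (pow-1# n)

  pow-unit : ∀ {x y} n → x * y ≈ 1# → pow x n * pow y n ≈ 1#
  pow-unit zero    xy≈1 = *-identityˡ 1#
  pow-unit {x} {y} (suc n) xy≈1 = begin
    (x * pow x n) * (y * pow y n)   ≈⟨ solve 4 (λ x y X Y → (x :* X) :* (y :* Y) := (x :* y) :* (X :* Y)) refl x y (pow x n) (pow y n) ⟩
    (x * y) * (pow x n * pow y n)   ≈⟨ *-cong xy≈1 (pow-unit n xy≈1) ⟩
    1# * 1#                         ≈⟨ *-identityˡ 1# ⟩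
    1#                              ∎

  one : Seq
  one = coeff (1# ∷ [])

  fromℕ-rec : ∀ a b c d → a ℕ.+ b ≡ 2 ℕ.* c ℕ.+ d → fromℕ a + fromℕ b ≈ fromℕ 2 * fromℕ c + fromℕ d
  fromℕ-rec a b c d eq = begin
    fromℕ a + fromℕ b              ≈⟨ fromℕ-+ a b ⟨
    fromℕ (a ℕ.+ b)                ≡⟨ ≡.cong fromℕ eq ⟩
    fromℕ (2 ℕ.* c ℕ.+ d)          ≈⟨ trans (fromℕ-+ (2 ℕ.* c) d) (+-congʳ (fromℕ-* 2 c)) ⟩
    fromℕ 2 * fromℕ c + fromℕ d    ∎

  oddBinomials : ℕ → Seq
  oddBinomials n i = fromℕ (oddBinomial n i)

  fpoly-coeff : ∀ n → coeff (fpoly n) ≋ oddBinomials n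
  fpoly-coeff n = coeff-map-applyUpTo (oddBinomials n) (λ k → k) (oddBinomials n) n (λ _ _ → refl) beyond
    where
    beyond : ∀ i → n ≤ i → oddBinomials n i ≈ 0#
    beyond i n≤i = reflexive (≡.cong fromℕ (k>n⇒nCk≡0 (s≤s (ℕ.≤-trans n≤i (ℕ.m≤m+n i _)))))

  fpoly-rec : ∀ n → addP (fpoly (suc (suc n))) (fpoly n) ≈P addP (scaleP (fromℕ 2) (fpoly (suc n))) (0# ∷ fpoly n)
  fpoly-rec n i = begin
    coeff (addP f₂ f₀) i                                   ≈⟨ coeff-addP f₂ f₀ i ⟩
    coeff f₂ i + coeff f₀ i                                ≈⟨ +-cong (fpoly-coeff (suc (suc n)) i) (fpoly-coeff n i) ⟩
    oddBinomials (suc (suc n)) i + oddBinomials n i        ≈⟨ oddBinomials-rec i ⟩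
    fromℕ 2 * oddBinomials (suc n) i + shift (oddBinomials n) i
      ≈⟨ +-cong (*-congˡ (fpoly-coeff (suc n) i)) (shift-cong (fpoly-coeff n) i) ⟨
    fromℕ 2 * coeff f₁ i + shift (coeff f₀) i              ≈⟨ +-cong (coeff-scaleP (fromℕ 2) f₁ i) (coeff-cons0 i) ⟨
    coeff (scaleP (fromℕ 2) f₁) i + coeff (0# ∷ f₀) i      ≈⟨ coeff-addP (scaleP (fromℕ 2) f₁) (0# ∷ f₀) i ⟨
    coeff (addP (scaleP (fromℕ 2) f₁) (0# ∷ f₀)) i         ∎
    where
    f₀ = fpoly n
    f₁ = fpoly (suc n)
    f₂ = fpoly (suc (suc n))
    oddBinomials-rec : ∀ i → oddBinomials (suc (suc n)) i + oddBinomials n i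
                              ≈ fromℕ 2 * oddBinomials (suc n) i + shift (oddBinomials n) i
    oddBinomials-rec zero    = fromℕ-rec (oddBinomial (suc (suc n)) 0) (oddBinomial n 0) (oddBinomial (suc n) 0) 0
                                 (oddBinomial-rec₀ n)
    oddBinomials-rec (suc j) = fromℕ-rec (oddBinomial (suc (suc n)) (suc j)) (oddBinomial n (suc j))
                                 (oddBinomial (suc n) (suc j)) (oddBinomial n j) (oddBinomial-rec n j)
    coeff-cons0 : coeff (0# ∷ f₀) ≋ shift (coeff f₀)
    coeff-cons0 zero    = refl
    coeff-cons0 (suc i) = refl

  open Composition 1# (- fromℕ 4)

  G : ℕ → Seq
  G n = composed (fpoly n)

  -- Composing the recurrence of f_n with 1 - 4x, the x·f_n term turns into
  -- (1 - 4x)·G_n, whose G_n cancels: G_{n+2} = 2·G_{n+1} - 4x·G_n.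
  G-rec : ∀ n → G (suc (suc n)) ≋ (λ i → fromℕ 2 * G (suc n) i + (- fromℕ 4) * shift (G n) i)
  G-rec n i = ∙-cancelʳ (G n i) _ _ (begin
    G (suc (suc n)) i + G n i                               ≈⟨ composed-addP f₂ f₀ i ⟨
    composed (addP f₂ f₀) i                                 ≈⟨ composed-resp (addP f₂ f₀) (addP (scaleP (fromℕ 2) f₁) (0# ∷ f₀)) (fpoly-rec n) i ⟩
    composed (addP (scaleP (fromℕ 2) f₁) (0# ∷ f₀)) i       ≈⟨ composed-addP (scaleP (fromℕ 2) f₁) (0# ∷ f₀) i ⟩
    composed (scaleP (fromℕ 2) f₁) i + composed (0# ∷ f₀) i
      ≈⟨ +-cong (composed-scaleP (fromℕ 2) f₁ i) (trans (composed-∷ 0# f₀ i) (linearStep-zero (G n) i)) ⟩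
    fromℕ 2 * G (suc n) i + (1# * G n i + c₄ * shift (G n) i)
      ≈⟨ +-congˡ (+-congʳ (*-identityˡ _)) ⟩
    fromℕ 2 * G (suc n) i + (G n i + c₄ * shift (G n) i)
      ≈⟨ solve 3 (λ T Y S → T :+ (Y :+ S) := (T :+ S) :+ Y) refl _ _ _ ⟩
    (fromℕ 2 * G (suc n) i + c₄ * shift (G n) i) + G n i    ∎)
    where
    c₄ = - fromℕ 4
    f₀ = fpoly n
    f₁ = fpoly (suc n)
    f₂ = fpoly (suc (suc n))

  G-initial₁ : G 1 ≋ one
  G-initial₁ i = trans (composed-resp (fpoly 1) (1# ∷ []) f₁≈1 i) (composed-constant 1# i)
    where
    f₁≈1 : fpoly 1 ≈P (1# ∷ [])
    f₁≈1 zero    = +-identityʳ 1#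
    f₁≈1 (suc i) = refl

  G-initial₂ : G 2 ≋ coeff (fromℕ 2 ∷ [])
  G-initial₂ i = trans (composed-resp (fpoly 2) (fromℕ 2 ∷ []) f₂≈2 i) (composed-constant (fromℕ 2) i)
    where
    f₂≈2 : fpoly 2 ≈P (fromℕ 2 ∷ [])
    f₂≈2 zero          = refl
    f₂≈2 (suc zero)    = refl
    f₂≈2 (suc (suc i)) = refl

  dickson : ℕ → Seq
  dickson m i = fromℕ (dicksonNumber m i) * pow (- 1#) i

  dcoeff≈dicksonNumber : ∀ m i → i ℕ.+ i ≤ suc m → dcoeff (suc m) i ≈ fromℕ (dicksonNumber m i)
  dcoeff≈dicksonNumber m zero    _      = refl
  dcoeff≈dicksonNumber m (suc j) 2i≤n = begin
    fromℕ ((m ∸ j) C suc j) - fromℕ A                  ≡⟨ ≡.cong (λ k → fromℕ k - fromℕ A) (dickson-pascal m j j j<m) ⟩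
    fromℕ (A ℕ.+ B) - fromℕ A                          ≈⟨ +-congʳ (fromℕ-+ A B) ⟩
    (fromℕ A + fromℕ B) - fromℕ A                      ≈⟨ solve 2 (λ a b → (a :+ b) :- a := b) refl (fromℕ A) (fromℕ B) ⟩
    fromℕ B                                            ∎
    where
    A = (m ∸ j ∸ 1) C j
    B = (m ∸ suc j) C suc j
    j<m : j < m
    j<m = ℕ.m+n≤o⇒n≤o j (ℕ.≤-pred 2i≤n)

  revDickson3-coeff : ∀ m → coeff (revDickson3 (suc m) 1#) ≋ dickson m
  revDickson3-coeff m = coeff-map-applyUpTo _ (λ k → k) (dickson m) (suc (suc m / 2)) within beyond
    where
    within : ∀ i → i < suc (suc m / 2) → dcoeff (suc m) i * (pow (- 1#) i * pow 1# (suc m ∸ 2 ℕ.* i)) ≈ dickson m i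
    within i (s≤s i≤n/2) = *-cong (dcoeff≈dicksonNumber m i (≤half⇒double≤ i≤n/2))
                                  (trans (*-congˡ (pow-1# (suc m ∸ 2 ℕ.* i))) (*-identityʳ _))
    beyond : ∀ i → suc (suc m / 2) ≤ i → dickson m i ≈ 0#
    beyond i n/2<i = trans (*-congʳ (reflexive (≡.cong fromℕ (dicksonNumber-vanish m i m<2i)))) (zeroˡ _)
      where m<2i = ℕ.≤-trans (ℕ.n≤1+n (suc m)) (half<⇒<double n/2<i)

  DicksonRec : (ℕ → Seq) → Set r₂
  DicksonRec u = ∀ m → u (suc (suc m)) ≋ (λ i → u (suc m) i - shift (u m) i)

  dickson-rec : DicksonRec dickson
  dickson-rec m zero    = sym (trans (+-congˡ -0#≈0#) (+-identityʳ _))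
  dickson-rec m (suc i) = begin
    fromℕ (dicksonNumber (suc (suc m)) (suc i)) * (- 1# * s)   ≡⟨ ≡.cong (λ k → fromℕ k * (- 1# * s)) (dicksonNumber-rec m i) ⟩
    fromℕ (A ℕ.+ B) * (- 1# * s)                               ≈⟨ *-cong (fromℕ-+ A B) (-1*x≈-x s) ⟩
    (fromℕ A + fromℕ B) * (- s)                                ≈⟨ solve 3 (λ a b s → (a :+ b) :* (:- s) := a :* (:- s) :- b :* s)
                                                                     refl (fromℕ A) (fromℕ B) s ⟩
    fromℕ A * (- s) - fromℕ B * s                              ≈⟨ +-congʳ (*-congˡ (-1*x≈-x s)) ⟨
    fromℕ A * (- 1# * s) - fromℕ B * s                         ∎
    where
    s = pow (- 1#) i
    A = dicksonNumber (suc m) (suc i)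
    B = dicksonNumber m i

  dickson-initial₀ : dickson 0 ≋ one
  dickson-initial₀ zero    = trans (*-identityʳ _) (+-identityʳ 1#)
  dickson-initial₀ (suc i) = zeroˡ _

  dickson-initial₁ : dickson 1 ≋ one
  dickson-initial₁ zero          = trans (*-identityʳ _) (+-identityʳ 1#)
  dickson-initial₁ (suc zero)    = zeroˡ _
  dickson-initial₁ (suc (suc i)) = zeroˡ _

  dicksonRec-unique : ∀ {u v} → DicksonRec u → DicksonRec v → u 0 ≋ v 0 → u 1 ≋ v 1 → ∀ m → u m ≋ v m
  dicksonRec-unique ru rv u₀≋v₀ u₁≋v₁ zero          = u₀≋v₀
  dicksonRec-unique ru rv u₀≋v₀ u₁≋v₁ (suc zero)    = u₁≋v₁
  dicksonRec-unique {u} {v} ru rv u₀≋v₀ u₁≋v₁ (suc (suc m)) i = begin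
    u (suc (suc m)) i                  ≈⟨ ru m i ⟩
    u (suc m) i - shift (u m) i        ≈⟨ +-cong (agree (suc m) i) (-‿cong (shift-cong (agree m) i)) ⟩
    v (suc m) i - shift (v m) i        ≈⟨ rv m i ⟨
    v (suc (suc m)) i                  ∎
    where agree = dicksonRec-unique ru rv u₀≋v₀ u₁≋v₁

  rescaled-dicksonRec : ∀ (H : ℕ → Seq) t c h → h * t ≈ 1# → (h * h) * c ≈ - 1# →
    (∀ n → H (suc (suc n)) ≋ (λ i → t * H (suc n) i + c * shift (H n) i)) →
    DicksonRec (λ m i → pow h m * H (suc m) i)
  rescaled-dicksonRec H t c h ht≈1 hhc≈-1 H-rec m i = begin
    (h * (h * W)) * H (suc (suc (suc m))) i     ≈⟨ *-congˡ (H-rec (suc m) i) ⟩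
    (h * (h * W)) * (t * X + c * S)             ≈⟨ solve 6 (λ h t c W X S → (h :* (h :* W)) :* (t :* X :+ c :* S)
                                                       := (h :* t) :* ((h :* W) :* X) :+ ((h :* h) :* c) :* (W :* S))
                                                       refl h t c W X S ⟩
    (h * t) * ((h * W) * X) + ((h * h) * c) * (W * S)
                                                ≈⟨ +-cong (trans (*-congʳ ht≈1) (*-identityˡ _)) (trans (*-congʳ hhc≈-1) (-1*x≈-x _)) ⟩
    (h * W) * X - W * S                         ≈⟨ +-congˡ (-‿cong (shift-scale W (H (suc m)) i)) ⟨
    (h * W) * X - shift (λ j → W * H (suc m) j) i ∎
    where
    W = pow h m
    X = H (suc (suc m)) i
    S = shift (H (suc m)) i

  -- Part one: F_{m+1}(1,x) = h^m·f_{m+1}(1 - 4x) whenever h·2 ≈ 1.  Both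
  -- sides satisfy the Dickson recurrence and start with 1, 1.
  revDickson3-identity : ∀ h → h * fromℕ 2 ≈ 1# → ∀ m →
    revDickson3 (suc m) 1# ≈P scaleP (pow h m) (compP (fpoly (suc m)) (1# ∷ (- fromℕ 4) ∷ []))
  revDickson3-identity h h2≈1 m i = begin
    coeff (revDickson3 (suc m) 1#) i           ≈⟨ revDickson3-coeff m i ⟩
    dickson m i                                ≈⟨ dicksonRec-unique dickson-rec
                                                    (rescaled-dicksonRec G (fromℕ 2) (- fromℕ 4) h h2≈1 hh4≈-1 G-rec)
                                                    initial₀ initial₁ m i ⟩
    pow h m * G (suc m) i                      ≈⟨ coeff-scaleP (pow h m) (compP (fpoly (suc m)) L) i ⟨
    coeff (scaleP (pow h m) (compP (fpoly (suc m)) L)) i ∎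
    where
    L = 1# ∷ (- fromℕ 4) ∷ []
    hh4≈-1 : (h * h) * (- fromℕ 4) ≈ - 1#
    hh4≈-1 = begin
      (h * h) * (- fromℕ 4)                  ≈⟨ solve 1 (λ h → (h :* h) :* (:- con (+ 4)) := :- ((h :* con (+ 2)) :* (h :* con (+ 2))))
                                                   refl h ⟩
      - ((h * fromℕ 2) * (h * fromℕ 2))      ≈⟨ -‿cong (trans (*-cong h2≈1 h2≈1) (*-identityˡ 1#)) ⟩
      - 1#                                   ∎
    initial₀ : dickson 0 ≋ (λ i → 1# * G 1 i)
    initial₀ i = trans (dickson-initial₀ i) (sym (trans (*-identityˡ _) (G-initial₁ i)))
    initial₁ : dickson 1 ≋ (λ i → (h * 1#) * G 2 i)
    initial₁ i = trans (dickson-initial₁ i) (sym (trans (*-congˡ (G-initial₂ i)) (at i)))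
      where
      at : ∀ i → (h * 1#) * coeff (fromℕ 2 ∷ []) i ≈ one i
      at zero    = trans (*-congʳ (*-identityʳ h)) h2≈1
      at (suc i) = zeroʳ _

  -- Part two: F_{m+1}(1,x) = h^m·f_{m+1}(ℓ x) with ℓ x = 1 - 4x a bijection
  -- (inverse y ↦ -h²(y - 1)) and h^m a unit, so one is a permutation
  -- polynomial iff the other is.
  revDickson3-permutation : ∀ h → h * fromℕ 2 ≈ 1# → ∀ m →
    IsPermPoly (revDickson3 (suc m) 1#) ⇔ IsPermPoly (fpoly (suc m))
  revDickson3-permutation h h2≈1 m =
    permPoly-equivalence F f (eval L) μ (pow h m) (pow (fromℕ 2) m)
      (eval-cong L) (λ x≈y → *-congˡ (+-congʳ x≈y))
      (linear-inverseʳ 1# (- fromℕ 4) d cd≈1) (linear-inverseˡ 1# (- fromℕ 4) d cd≈1)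
      (pow-unit m h2≈1) F≈uf∘ℓ
    where
    F = revDickson3 (suc m) 1#
    f = fpoly (suc m)
    L = 1# ∷ (- fromℕ 4) ∷ []
    d = - (h * h)
    μ : Carrier → Carrier
    μ y = d * (y - 1#)
    cd≈1 : (- fromℕ 4) * d ≈ 1#
    cd≈1 = begin
      (- fromℕ 4) * (- (h * h))              ≈⟨ solve 1 (λ h → (:- con (+ 4)) :* (:- (h :* h)) := (h :* con (+ 2)) :* (h :* con (+ 2)))
                                                   refl h ⟩
      (h * fromℕ 2) * (h * fromℕ 2)          ≈⟨ trans (*-cong h2≈1 h2≈1) (*-identityˡ 1#) ⟩
      1#                                     ∎
    F≈uf∘ℓ : ∀ x → eval F x ≈ pow h m * eval f (eval L x)
    F≈uf∘ℓ x = begin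
      eval F x                               ≈⟨ eval-resp F (scaleP (pow h m) (compP f L)) (revDickson3-identity h h2≈1 m) x ⟩
      eval (scaleP (pow h m) (compP f L)) x  ≈⟨ eval-scaleP (pow h m) (compP f L) x ⟩
      pow h m * eval (compP f L) x           ≈⟨ *-congˡ (eval-compP f L x) ⟩
      pow h m * eval f (eval L x)            ∎

  -- In characteristic an odd prime p, 2 is invertible: -(p-1)/2 · 2 = 1 - p = 1.
  two-invertible : ∀ {p} → Prime p → p ≢ 2 → fromℕ p ≈ 0# → (- fromℕ (p / 2)) * fromℕ 2 ≈ 1#
  two-invertible {p} p-prime p≢2 p≈0 = begin
    (- K) * fromℕ 2                ≈⟨ solve 2 (λ o K → (:- K) :* con (+ 2) := o :- (o :+ K :* con (+ 2))) refl 1# K ⟩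
    1# - (1# + K * fromℕ 2)        ≈⟨ +-congˡ (-‿cong (trans 1+2K≈p p≈0)) ⟩
    1# - 0#                        ≈⟨ trans (+-congˡ -0#≈0#) (+-identityʳ 1#) ⟩
    1#                             ∎
    where
    K = fromℕ (p / 2)
    1+2K≈p : 1# + K * fromℕ 2 ≈ fromℕ p
    1+2K≈p = sym (trans (reflexive (≡.cong fromℕ (oddPrime-decomposition p-prime p≢2)))
                        (+-congˡ (fromℕ-* (p / 2) 2)))

proposition3p2 : ∀ {c ℓ} (R : CommutativeRing c ℓ) (p q k : ℕ) → Prime p → p ≢ 2 →
    q ≡ p ^ k → IsFiniteField R q → CommutativeRing._≈_ R (RingOps.fromℕ R p) (CommutativeRing.0# R) →
    (n : ℕ) → 1 ≤ n →
    let open CommutativeRing R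
        open Poly R
    in (∀ h → h * fromℕ 2 ≈ 1# →
          revDickson3 n 1# ≈P scaleP (pow h (n ∸ 1)) (compP (fpoly n) (1# ∷ (- fromℕ 4) ∷ [])))
       × (IsPermPoly (revDickson3 n 1#) ⇔ IsPermPoly (fpoly n))
proposition3p2 R p _ _ p-prime p≢2 _ _ p≈0 (suc m) _ =
    (λ h h2≈1 → revDickson3-identity h h2≈1 m)
  , revDickson3-permutation (- fromℕ (p / 2)) (two-invertible p-prime p≢2 p≈0) m
  where
  open CommutativeRing R using (-_)
  open RingOps R using (fromℕ)
  open Development R
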